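{- Let $\mathbf{x}$ be a reversal-closed sequence. Then $\mathbf{x}$ is rich if and only if $r_{\mathbf{x}}(n+1)+r_{\mathbf{x}}(n) = \rho_{\mathbf{x}}(n+1)+1$ for all $n\ge 0$.
   Context: A factor of a sequence is a finite contiguous block. For a finite word $u=u(1)\cdots u(m)$, its reversal is $u^R=u(m)\cdots u(1)$; a palindrome is a word with $u=u^R$; $u$ and $v$ are reflectively equivalent if $v=u$ or $v=u^R$. The reflection complexity $r_{\mathbf{x}}(n)$ is the number of distinct length-$n$ factors of $\mathbf{x}$ up to reflective equivalence; $\rho_{\mathbf{x}}(n)$ is the number of distinct length-$n$ factors. A sequence is reversal-closed if for every factor $w$, $w^R$ is also a factor. A finite word $w$ has at most $|w|+1$ distinct palindromic factors (counting the empty word); a sequence is rich if each of its factors $w$ has exactly $|w|+1$ distinct palindromic factors. -}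

module Defs where

open import Data.Nat using (ℕ; _+_; suc)
open import Data.Fin using (Fin)
open import Data.Fin.Properties using () renaming (_≟_ to _≟ᶠ_)
open import Data.List using (List; []; _∷_; map; upTo; length; reverse; inits; tails; concatMap; filter; deduplicate)
open import Data.List.Properties using (≡-dec)
open import Data.List.Membership.Propositional using (_∈_)
open import Data.List.Relation.Unary.Any using (Any)
open import Data.List.Relation.Unary.All using (All)
open import Data.List.Relation.Unary.AllPairs using (AllPairs)
open import Data.Product using (Σ; ∃; _×_)
open import Data.Sum using (_⊎_)
open import Relation.Nullary using (¬_)
open import Relation.Binary.PropositionalEquality using (_≡_)

Seq : ℕ → Set
Seq k = ℕ → Fin k

Word : ℕ → Set
Word k = List (Fin k)

factorAt : ∀ {k} → Seq k → ℕ → ℕ → Word k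
factorAt x i n = map (λ j → x (i + j)) (upTo n)

IsFactor : ∀ {k} → Seq k → Word k → Set
IsFactor x w = ∃ λ i → factorAt x i (length w) ≡ w

IsFactorOfLength : ∀ {k} → Seq k → ℕ → Word k → Set
IsFactorOfLength x n w = IsFactor x w × length w ≡ n

ReversalClosed : ∀ {k} → Seq k → Set
ReversalClosed x = ∀ w → IsFactor x w → IsFactor x (reverse w)

ReflEquiv : ∀ {k} → Word k → Word k → Set
ReflEquiv u v = v ≡ u ⊎ v ≡ reverse u

Palindrome : ∀ {k} → Word k → Set
Palindrome w = w ≡ reverse w

_≟w_ : ∀ {k} (u v : Word k) → Relation.Nullary.Dec (u ≡ v)
_≟w_ = ≡-dec _≟ᶠ_

allFactors : ∀ {k} → Word k → List (Word k)
allFactors w = concatMap inits (tails w)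

-- number of distinct palindromic factors of w (counting the empty word)
palCount : ∀ {k} → Word k → ℕ
palCount w = length (deduplicate _≟w_ (filter (λ u → u ≟w reverse u) (allFactors w)))

Rich : ∀ {k} → Seq k → Set
Rich x = ∀ w → IsFactor x w → palCount w ≡ length w + 1

-- "the number of length-n factors of x, counted up to the equivalence E, is m":
-- there is a list of m length-n factors, pairwise non-E-equivalent, such that every
-- length-n factor is E-equivalent to one of them.
CountUpTo : ∀ {k} → (Word k → Word k → Set) → Seq k → ℕ → ℕ → Set
CountUpTo E x n m =
  Σ (List (Word _)) λ L →
    length L ≡ m
    × All (IsFactorOfLength x n) L
    × AllPairs (λ u v → ¬ E u v) L
    × (∀ w → IsFactorOfLength x n w → Any (E w) L)

FactorComplexity : ∀ {k} → Seq k → ℕ → ℕ → Set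
FactorComplexity = CountUpTo _≡_

ReflComplexity : ∀ {k} → Seq k → ℕ → ℕ → Set
ReflComplexity = CountUpTo ReflEquiv

-- Choose N such that every factor of length n + 1 occurs at a position below N (so every
-- factor of length n occurs below N + 1) and count positions of first occurrences. Then
-- r(n + 1) is the number of i < N at which the factor of length n + 1 occurs for the first time
-- up to reversal (ReflNew), r(n) is 1 plus the number of i < N with ReflNew n (i + 1), and, as x
-- is reversal-closed, ρ(n + 1) is r(n + 1) plus the number of i < N at which the factor is
-- moreover not a palindrome (NonPalNew). As ReflNew n (i + 1) implies NonPalNew (n + 1) i, the
-- identity at n holds iff the converse implication holds at every position.
--
-- The converse holds everywhere iff every nonempty prefix of x ends with a palindrome occurring
-- there for the first time. Such a palindrome ending at position i + n either lies within
-- x[i + 1 .. i + n], which then occurs for the first time up to reversal, or has x[i .. i + n]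
-- as a suffix, whose reverse is then a prefix of it, so that x[i .. i + n] is a palindrome or
-- not new up to reversal. Conversely, starting from the whole prefix and dropping first letters
-- while the block is not a palindrome keeps it new up to reversal, and the empty block is not
-- new at a positive position, so a new palindromic suffix is reached.
--
-- Finally, prepending a letter to a word adds at most one palindromic factor, its longest
-- palindromic prefix, since the shorter palindromic prefixes are suffixes of that one. Hence
-- palCount w ≤ |w| + 1 and palCount (u ++ w) ≤ |u| + palCount w, and x is rich iff appending
-- each letter to a prefix adds a palindrome, i.e. iff every nonempty prefix has a new
-- palindromic suffix.

module Submission where

open import Defs
open import Data.Bool using (true; false)
open import Data.Empty using (⊥-elim)
open import Data.Fin using (Fin)
open import Data.List
  using (List; []; _∷_; [_]; _++_; _∷ʳ_; map; length; reverse; filter; upTo; applyUpTo; inits; deduplicate)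
open import Data.List.Properties
  using ( ∷-injectiveˡ; ∷-injectiveʳ; ∷ʳ-injective; ++-assoc; ++-identityʳ; length-++; length-map; length-reverse
        ; length-deduplicate; reverse-++; reverse-involutive; reverse-selfInverse; reverse-injective; unfold-reverse; filter-accept; map-upTo)
open import Data.List.Membership.Propositional using (_∈_; _∉_; lose)
open import Data.List.Membership.Propositional.Properties
  using (∈-upTo⁺; ∈-filter⁺; ∈-filter⁻; ∈-deduplicate⁺; ∈-deduplicate⁻; ∈-map⁺; ∈-map⁻; ∈-++⁺ˡ; ∈-++⁺ʳ; ∈-++⁻)
open import Data.List.Relation.Binary.Equality.Propositional using (≋⇒≡)
open import Data.List.Relation.Binary.Sublist.Propositional using (⊆-refl) renaming (_⊆_ to _⊑_)
open import Data.List.Relation.Binary.Sublist.Propositional.Properties using (filter⁺; length-mono-≤; to-≋)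
open import Data.List.Relation.Unary.All as All using (All; []; _∷_)
import Data.List.Relation.Unary.All.Properties as Allₚ
open import Data.List.Relation.Unary.AllPairs as AllPairs using (AllPairs; []; _∷_)
import Data.List.Relation.Unary.AllPairs.Properties as AllPairsₚ
open import Data.List.Relation.Unary.Any using (Any; here; there)
import Data.List.Relation.Unary.Any.Properties as Anyₚ
open import Data.List.Relation.Unary.Unique.DecPropositional.Properties using (deduplicate-!)
import Data.List.Fresh as List#
import Data.List.Fresh.Relation.Unary.Any as Any#
open import Data.Nat using (ℕ; zero; suc; _+_; _⊔_; _≤_; _<_; s≤s; z<s)
open import Data.Nat.Properties
open import Algebra.Properties.CommutativeSemigroup +-commutativeSemigroup using (x∙yz≈xz∙y; xy∙z≈x∙zy)
open import Data.List.Extrema ≤-totalOrder using (argmax; argmax-all; f[xs]≤f[argmax])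
open import Data.Product using (∃; ∃₂; _×_; _,_; proj₁; proj₂; swap)
open import Data.Sum using (inj₁; inj₂)
open import Function using (_∘_; id; _⇔_; mk⇔; Equivalence)
open import Relation.Binary using (Setoid; IsEquivalence; Rel)
open import Relation.Binary.Definitions using (tri<; tri≈; tri>)
open import Relation.Binary.PropositionalEquality as ≡
  using (_≡_; _≢_; refl; sym; trans; cong; cong₂; subst; subst₂; module ≡-Reasoning)
open import Relation.Nullary using (¬_; Dec; does; yes; no)
open import Relation.Nullary.Decidable using (_⊎-dec_; _×-dec_; ¬?)
open import Relation.Unary using (Pred; Decidable; _⊆_)

module _ {c ℓ} (S : Setoid c ℓ) where
  open import Data.List.Membership.Setoid S using () renaming (_∈_ to _∈ₛ_)
  open import Data.List.Relation.Unary.Unique.Setoid S using (Unique)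
  open import Data.List.Fresh.Membership.Setoid S using () renaming (_∈_ to _∈#_)
  open import Data.List.Fresh.Membership.Setoid.Properties S using (injection)

  private
    length-fromList : ∀ {xs} (u : Unique xs) → List#.length (List#.fromList u) ≡ length xs
    length-fromList [] = refl
    length-fromList (_ ∷ u) = cong suc (length-fromList u)

    ∈-fromList⁻ : ∀ {x xs} (u : Unique xs) → x ∈# List#.fromList u → x ∈ₛ xs
    ∈-fromList⁻ (_ ∷ u) (Any#.here p) = here p
    ∈-fromList⁻ (_ ∷ u) (Any#.there p) = there (∈-fromList⁻ u p)

    ∈-fromList⁺ : ∀ {x xs} (u : Unique xs) → x ∈ₛ xs → x ∈# List#.fromList u
    ∈-fromList⁺ (_ ∷ u) (here p) = Any#.here p
    ∈-fromList⁺ (_ ∷ u) (there p) = Any#.there (∈-fromList⁺ u p)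

  unique-length-≤ : ∀ {xs ys} → Unique xs → Unique ys → (∀ {x} → x ∈ₛ xs → x ∈ₛ ys) →
                    length xs ≤ length ys
  unique-length-≤ uxs uys xs⊆ys = subst₂ _≤_ (length-fromList uxs) (length-fromList uys)
    (injection id (∈-fromList⁺ uys ∘ xs⊆ys ∘ ∈-fromList⁻ uxs))

module _ {a p q} {A : Set a} {P : Pred A p} {Q : Pred A q}
         (P? : Decidable P) (Q? : Decidable Q) (P⊆Q : P ⊆ Q) where

  private
    filter-⊑ : ∀ xs → filter P? xs ⊑ filter Q? xs
    filter-⊑ xs = filter⁺ P? Q? (λ { refl → P⊆Q }) (⊆-refl {x = xs})

  length-filter-mono : ∀ xs → length (filter P? xs) ≤ length (filter Q? xs)
  length-filter-mono xs = length-mono-≤ (filter-⊑ xs)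

  length-filter-≡⇒⊇ : ∀ xs → length (filter P? xs) ≡ length (filter Q? xs) → ∀ {x} → x ∈ xs → Q x → P x
  length-filter-≡⇒⊇ xs eq x∈xs Qx =
    ∈-filter⁻ P? {xs = xs} (subst (_ ∈_) (sym filters≡) (∈-filter⁺ Q? x∈xs Qx)) .proj₂
    where
    filters≡ : filter P? xs ≡ filter Q? xs
    filters≡ = ≋⇒≡ (to-≋ eq (filter-⊑ xs))

module _ {a p r} {A : Set a} {P : Pred A p} {R : Rel A r} (P? : Decidable P) where

  AllPairs-filter⁺ : ∀ {xs} → AllPairs (λ x y → P y → R x y) xs → AllPairs R (filter P? xs)
  AllPairs-filter⁺ {[]} [] = []
  AllPairs-filter⁺ {x ∷ xs} (rs ∷ rss) with does (P? x)
  ... | true = All.zipWith (λ (r , Py) → r Py) (Allₚ.filter⁺ P? rs , Allₚ.all-filter P? xs)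
             ∷ AllPairs-filter⁺ rss
  ... | false = AllPairs-filter⁺ rss

module _ {a b p} {A : Set a} {B : Set b} {P : Pred B p} (P? : Decidable P) where

  filter-map : ∀ (f : A → B) xs → filter P? (map f xs) ≡ map f (filter (P? ∘ f) xs)
  filter-map f [] = refl
  filter-map f (x ∷ xs) with does (P? (f x))
  ... | true = cong (f x ∷_) (filter-map f xs)
  ... | false = filter-map f xs

All-∃-bounded : ∀ {a p} {A : Set a} {P : ℕ → A → Set p} (xs : List A) → All (λ v → ∃ λ i → P i v) xs →
                ∃ λ N → All (λ v → ∃ λ i → i < N × P i v) xs
All-∃-bounded [] [] = 0 , []
All-∃-bounded (v ∷ xs) ((i , Piv) ∷ rest) =
  let (N , below) = All-∃-bounded xs rest
  in suc (i ⊔ N) , (i , s≤s (m≤m⊔n i N) , Piv)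
                 ∷ All.map (λ (j , j<N , Pjv) → j , m<n⇒m<1+n (<-≤-trans j<N (m≤n⊔m i N)) , Pjv) below

count : ∀ {p} {P : Pred ℕ p} → Decidable P → ℕ → ℕ
count P? N = length (filter P? (upTo N))

module _ {p} {P : Pred ℕ p} (P? : Decidable P) where

  ∈-map-filter-upTo⁺ : ∀ {b} {B : Set b} (f : ℕ → B) {i N} → i < N → P i → f i ∈ map f (filter P? (upTo N))
  ∈-map-filter-upTo⁺ f i<N Pi = ∈-map⁺ f (∈-filter⁺ P? (∈-upTo⁺ i<N) Pi)

  count-suc : ∀ {N} → P 0 → count P? (suc N) ≡ suc (count (P? ∘ suc) N)
  count-suc {N} P0 = begin
    length (filter P? (0 ∷ applyUpTo suc N))              ≡⟨ cong length (filter-accept P? P0) ⟩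
    suc (length (filter P? (applyUpTo suc N)))             ≡⟨ cong (suc ∘ length ∘ filter P?) (map-upTo suc N) ⟨
    suc (length (filter P? (map suc (upTo N))))            ≡⟨ cong (suc ∘ length) (filter-map P? suc (upTo N)) ⟩
    suc (length (map suc (filter (P? ∘ suc) (upTo N))))    ≡⟨ cong suc (length-map suc (filter (P? ∘ suc) (upTo N))) ⟩
    suc (count (P? ∘ suc) N)                               ∎
    where open ≡-Reasoning

  least : ∀ n → (∃ λ i → i < n × P i) → ∃ λ m → m < n × P m × (∀ {j} → j < m → ¬ P j)
  least (suc n) (i , i<1+n , Pi) with anyUpTo? P? n | m<1+n⇒m<n∨m≡n i<1+n
  ... | yes below | _ = let (m , m<n , Pm , minimal) = least n below in m , m<n⇒m<1+n m<n , Pm , minimal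
  ... | no ¬below | inj₁ i<n = ⊥-elim (¬below (i , i<n , Pi))
  ... | no ¬below | inj₂ refl = i , ≤-refl , Pi , λ j<i Pj → ¬below (_ , j<i , Pj)

module _ {a} {A : Set a} where

  ++-injective : ∀ (u v : List A) {s t} → length u ≡ length v → u ++ s ≡ v ++ t → u ≡ v × s ≡ t
  ++-injective [] [] _ eq = refl , eq
  ++-injective (x ∷ u) (y ∷ v) |u|≡|v| eq =
    let (u≡v , s≡t) = ++-injective u v (suc-injective |u|≡|v|) (∷-injectiveʳ eq)
    in cong₂ _∷_ (∷-injectiveˡ eq) u≡v , s≡t

  ++-prefix : ∀ (u v : List A) {s t} → length u ≤ length v → u ++ s ≡ v ++ t → ∃ λ q → v ≡ u ++ q
  ++-prefix [] v _ _ = v , refl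
  ++-prefix (x ∷ u) (y ∷ v) (s≤s |u|≤|v|) eq with ++-prefix u v |u|≤|v| (∷-injectiveʳ eq)
  ... | q , refl = q , cong (_∷ u ++ q) (sym (∷-injectiveˡ eq))

  ∈-inits⁺ : ∀ (u s : List A) → u ∈ inits (u ++ s)
  ∈-inits⁺ [] s = here refl
  ∈-inits⁺ (x ∷ u) s = there (∈-map⁺ (x ∷_) (∈-inits⁺ u s))

  ∈-inits⁻ : ∀ {u : List A} v → u ∈ inits v → ∃ λ s → v ≡ u ++ s
  ∈-inits⁻ v (here refl) = v , refl
  ∈-inits⁻ (x ∷ v) (there mem) with ∈-map⁻ (x ∷_) {xs = inits v} mem
  ... | u , u∈inits , refl = let (s , eq) = ∈-inits⁻ v u∈inits in s , cong (x ∷_) eq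

-- Palindromic factors of words

module _ {k : ℕ} where
  open import Data.List.Relation.Unary.Unique.Propositional using (Unique)

  ∈-allFactors⁺ : ∀ (p u s : Word k) → u ∈ allFactors (p ++ u ++ s)
  ∈-allFactors⁺ [] u s = ∈-++⁺ˡ (∈-inits⁺ u s)
  ∈-allFactors⁺ (x ∷ p) u s = ∈-++⁺ʳ (inits (x ∷ p ++ u ++ s)) (∈-allFactors⁺ p u s)

  ∈-allFactors⁻ : ∀ {u} (w : Word k) → u ∈ allFactors w → ∃₂ λ p s → w ≡ p ++ u ++ s
  ∈-allFactors⁻ [] (here refl) = [] , [] , refl
  ∈-allFactors⁻ (x ∷ w) mem with ∈-++⁻ (inits (x ∷ w)) mem
  ... | inj₁ prefix = let (s , eq) = ∈-inits⁻ (x ∷ w) prefix in [] , s , eq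
  ... | inj₂ inTail = let (p , s , eq) = ∈-allFactors⁻ w inTail in x ∷ p , s , cong (x ∷_) eq

  ∈-allFactors-∷ : ∀ (p : Word k) {a w u s} → 0 < length p → a ∷ w ≡ p ++ u ++ s → u ∈ allFactors w
  ∈-allFactors-∷ (_ ∷ p) _ eq = subst (λ v → _ ∈ allFactors v) (sym (∷-injectiveʳ eq)) (∈-allFactors⁺ p _ _)

  ∈-allFactors-++⁺ : ∀ {u} (w v : Word k) → u ∈ allFactors w → u ∈ allFactors (w ++ v)
  ∈-allFactors-++⁺ {u} w v u∈w with ∈-allFactors⁻ w u∈w
  ... | p , s , refl = subst (λ z → u ∈ allFactors z) reassociate (∈-allFactors⁺ p u (s ++ v))
    where
    reassociate : p ++ u ++ s ++ v ≡ (p ++ u ++ s) ++ v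
    reassociate = sym (trans (++-assoc p (u ++ s) v) (cong (p ++_) (++-assoc u s v)))

  palindrome-++-prefix : ∀ (u v r : Word k) {s} → Palindrome (u ++ v) → r ++ s ≡ u ++ v →
                         length r ≡ length v → r ≡ reverse v
  palindrome-++-prefix u v r pal eq |r|≡|v| =
    ++-injective r (reverse v) (trans |r|≡|v| (sym (length-reverse v))) (trans eq (trans pal (reverse-++ u v))) .proj₁

  reverse-++-palindrome : ∀ (u v r : Word k) {s} → Palindrome v → r ++ s ≡ reverse (u ++ v) →
                          length r ≡ length v → r ≡ v
  reverse-++-palindrome u v r pal eq |r|≡|v| =
    ++-injective r v |r|≡|v| (trans eq (trans (reverse-++ u v) (cong (_++ reverse u) (sym pal)))) .proj₁

  PalFactors : Word k → List (Word k)
  PalFactors w = deduplicate _≟w_ (filter (λ u → u ≟w reverse u) (allFactors w))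

  ∈-PalFactors⁻ : ∀ {u} w → u ∈ PalFactors w → Palindrome u × u ∈ allFactors w
  ∈-PalFactors⁻ w mem =
    swap (∈-filter⁻ (λ u → u ≟w reverse u) {xs = allFactors w} (∈-deduplicate⁻ _≟w_ _ mem))

  ∈-PalFactors⁺ : ∀ {u} w → Palindrome u → u ∈ allFactors w → u ∈ PalFactors w
  ∈-PalFactors⁺ w pal mem = ∈-deduplicate⁺ _≟w_ (∈-filter⁺ (λ u → u ≟w reverse u) mem pal)

  PalFactors-unique : ∀ w → Unique (PalFactors w)
  PalFactors-unique w = deduplicate-! _≟w_ (filter (λ u → u ≟w reverse u) (allFactors w))

  palCount-mono : ∀ v w → (∀ {u} → Palindrome u → u ∈ allFactors v → u ∈ allFactors w) →
                  palCount v ≤ palCount w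
  palCount-mono v w pal⊆ = unique-length-≤ (≡.setoid _) (PalFactors-unique v) (PalFactors-unique w)
    λ mem → let (pal , u∈v) = ∈-PalFactors⁻ v mem in ∈-PalFactors⁺ w pal (pal⊆ pal u∈v)

  palCount-< : ∀ v w {u} → (∀ {u} → u ∈ allFactors w → u ∈ allFactors v) →
               Palindrome u → u ∈ allFactors v → u ∉ allFactors w → palCount w < palCount v
  palCount-< v w {u} w⊆v pal u∈v u∉w =
    unique-length-≤ (≡.setoid _) (All.tabulate u≢ ∷ PalFactors-unique w) (PalFactors-unique v)
      λ { (here refl) → ∈-PalFactors⁺ v pal u∈v
        ; (there mem) → let (pal′ , mem′) = ∈-PalFactors⁻ w mem in ∈-PalFactors⁺ v pal′ (w⊆v mem′) }
    where
    u≢ : ∀ {y} → y ∈ PalFactors w → u ≢ y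
    u≢ mem refl = u∉w (∈-PalFactors⁻ w mem .proj₂)

  longestPalPrefix : Word k → Word k
  longestPalPrefix w = argmax length [] (filter (λ u → u ≟w reverse u) (inits w))

  longestPalPrefix-isPalPrefix : ∀ w → Palindrome (longestPalPrefix w) × longestPalPrefix w ∈ inits w
  longestPalPrefix-isPalPrefix w = argmax-all length (refl , here refl)
    (All.zip (Allₚ.all-filter pal? (inits w) , Allₚ.filter⁺ pal? (All.tabulate id)))
    where pal? = λ (u : Word k) → u ≟w reverse u

  longestPalPrefix-longest : ∀ {u} w → Palindrome u → u ∈ inits w → length u ≤ length (longestPalPrefix w)
  longestPalPrefix-longest w pal u∈inits =
    All.lookup (f[xs]≤f[argmax] {f = length} [] (filter pal? (inits w))) (∈-filter⁺ pal? u∈inits pal)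
    where pal? = λ (u : Word k) → u ≟w reverse u

  shorterPalPrefix-∈-allFactors : ∀ {a w} (u v : Word k) {s t} → Palindrome u → Palindrome v → length u < length v →
                                  a ∷ w ≡ u ++ s → a ∷ w ≡ v ++ t → u ∈ allFactors w
  shorterPalPrefix-∈-allFactors {a} {w} u v {s} {t} palu palv |u|<|v| eqᵤ eqᵥ
    with ++-prefix u v (<⇒≤ |u|<|v|) (trans (sym eqᵤ) eqᵥ)
  ... | q , refl = ∈-allFactors-∷ (reverse q) (0<length-reverse q |u|<|v|) (begin
    a ∷ w                         ≡⟨ eqᵥ ⟩
    (u ++ q) ++ t                 ≡⟨ cong (_++ t) palv ⟩
    reverse (u ++ q) ++ t         ≡⟨ cong (_++ t) (reverse-++ u q) ⟩
    (reverse q ++ reverse u) ++ t ≡⟨ cong (λ z → (reverse q ++ z) ++ t) (sym palu) ⟩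
    (reverse q ++ u) ++ t         ≡⟨ ++-assoc (reverse q) u t ⟩
    reverse q ++ u ++ t           ∎)
    where
    open ≡-Reasoning
    0<length-reverse : ∀ q → length u < length (u ++ q) → 0 < length (reverse q)
    0<length-reverse [] |u|<|u| = ⊥-elim (<-irrefl (cong length (sym (++-identityʳ u))) |u|<|u|)
    0<length-reverse (b ∷ q) _ = subst (0 <_) (sym (length-reverse (b ∷ q))) z<s

  palCount-∷-≤ : ∀ a w → palCount (a ∷ w) ≤ suc (palCount w)
  palCount-∷-≤ a w = begin
    palCount (a ∷ w)                             ≤⟨ unique-length-≤ (≡.setoid _) (PalFactors-unique (a ∷ w))
                                                      (deduplicate-! _≟w_ (L ∷ PalFactors w))
                                                      (∈-deduplicate⁺ _≟w_ ∘ PalFactors⊆L∷PalFactors) ⟩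
    length (deduplicate _≟w_ (L ∷ PalFactors w)) ≤⟨ length-deduplicate _≟w_ (L ∷ PalFactors w) ⟩
    suc (palCount w)                             ∎
    where
    open ≤-Reasoning
    L = longestPalPrefix (a ∷ w)
    PalFactors⊆L∷PalFactors : ∀ {u} → u ∈ PalFactors (a ∷ w) → u ∈ L ∷ PalFactors w
    PalFactors⊆L∷PalFactors {u} mem with ∈-PalFactors⁻ (a ∷ w) mem
    ... | pal , u∈ with ∈-++⁻ (inits (a ∷ w)) u∈
    ...   | inj₂ u∈w = there (∈-PalFactors⁺ w pal u∈w)
    ...   | inj₁ prefix with longestPalPrefix-isPalPrefix (a ∷ w)
                           | m≤n⇒m<n∨m≡n (longestPalPrefix-longest (a ∷ w) pal prefix)
    ...     | palL , prefixL | inj₁ |u|<|L| =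
      let (s , eqᵤ) = ∈-inits⁻ (a ∷ w) prefix ; (t , eqL) = ∈-inits⁻ (a ∷ w) prefixL
      in there (∈-PalFactors⁺ w pal (shorterPalPrefix-∈-allFactors u L pal palL |u|<|L| eqᵤ eqL))
    ...     | _ , prefixL | inj₂ |u|≡|L| =
      let (s , eqᵤ) = ∈-inits⁻ (a ∷ w) prefix ; (t , eqL) = ∈-inits⁻ (a ∷ w) prefixL
      in here (++-injective u L |u|≡|L| (trans (sym eqᵤ) eqL) .proj₁)

  palCount-≤-length : ∀ w → palCount w ≤ suc (length w)
  palCount-≤-length [] = ≤-refl
  palCount-≤-length (a ∷ w) = ≤-trans (palCount-∷-≤ a w) (s≤s (palCount-≤-length w))

  palCount-++-≤ : ∀ u w → palCount (u ++ w) ≤ length u + palCount w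
  palCount-++-≤ [] w = ≤-refl
  palCount-++-≤ (a ∷ u) w = ≤-trans (palCount-∷-≤ a (u ++ w)) (s≤s (palCount-++-≤ u w))

  ReflEquiv-sym : ∀ {u v : Word k} → ReflEquiv u v → ReflEquiv v u
  ReflEquiv-sym (inj₁ refl) = inj₁ refl
  ReflEquiv-sym {u} (inj₂ refl) = inj₂ (sym (reverse-involutive u))

  ReflEquiv-trans : ∀ {u v w : Word k} → ReflEquiv u v → ReflEquiv v w → ReflEquiv u w
  ReflEquiv-trans (inj₁ refl) v≈w = v≈w
  ReflEquiv-trans (inj₂ refl) (inj₁ refl) = inj₂ refl
  ReflEquiv-trans {u} (inj₂ refl) (inj₂ refl) = inj₁ (reverse-involutive u)

  ReflEquiv-isEquivalence : IsEquivalence (ReflEquiv {k})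
  ReflEquiv-isEquivalence = record { refl = inj₁ refl ; sym = ReflEquiv-sym ; trans = ReflEquiv-trans }

  ReflEquiv? : ∀ (u v : Word k) → Dec (ReflEquiv u v)
  ReflEquiv? u v = (v ≟w u) ⊎-dec (v ≟w reverse u)

CountUpTo-functional : ∀ {k} {E : Word k → Word k → Set} → IsEquivalence E →
  ∀ {x n a b} → CountUpTo E x n a → CountUpTo E x n b → a ≡ b
CountUpTo-functional {k} {E} isEquiv {x} {n}
  (La , refl , factorsᵃ , uniqueᵃ , coverᵃ) (Lb , refl , factorsᵇ , uniqueᵇ , coverᵇ) =
  ≤-antisym (embed factorsᵃ uniqueᵃ uniqueᵇ coverᵇ) (embed factorsᵇ uniqueᵇ uniqueᵃ coverᵃ)
  where
  S : Setoid _ _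
  S = record { isEquivalence = isEquiv }
  open import Data.List.Membership.Setoid.Properties using (∈-resp-≈)
  open import Data.List.Relation.Unary.Unique.Setoid S using (Unique)
  embed : ∀ {L L′} → All (IsFactorOfLength x n) L → Unique L → Unique L′ →
          (∀ w → IsFactorOfLength x n w → Any (E w) L′) → length L ≤ length L′
  embed factors u u′ cover = unique-length-≤ S u u′ (All.lookupₛ S (∈-resp-≈ S) (All.map (cover _) factors))

-- Factors of a sequence

module _ {k : ℕ} (x : Seq k) where

  factor : ℕ → ℕ → Word k
  factor i zero = []
  factor i (suc n) = x i ∷ factor (suc i) n

  prefix : ℕ → Word k
  prefix = factor 0

  length-factor : ∀ i n → length (factor i n) ≡ n
  length-factor i zero = refl
  length-factor i (suc n) = cong suc (length-factor (suc i) n)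

  factor-++ : ∀ i m n → factor i (m + n) ≡ factor i m ++ factor (i + m) n
  factor-++ i zero n = cong (λ j → factor j n) (sym (+-identityʳ i))
  factor-++ i (suc m) n =
    cong (x i ∷_) (trans (factor-++ (suc i) m n) (cong (λ j → factor (suc i) m ++ factor j n) (sym (+-suc i m))))

  factor-∷ʳ : ∀ i n → factor i (suc n) ≡ factor i n ∷ʳ x (i + n)
  factor-∷ʳ i n = trans (cong (factor i) (+-comm 1 n)) (factor-++ i n 1)

  factor-prefix : ∀ i n (u : Word k) {s} → factor i n ≡ u ++ s → factor i (length u) ≡ u
  factor-prefix i n [] eq = refl
  factor-prefix i (suc n) (c ∷ u) eq = cong₂ _∷_ (∷-injectiveˡ eq) (factor-prefix (suc i) n u (∷-injectiveʳ eq))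

  factor-infix : ∀ i n (p u : Word k) {s} → factor i n ≡ p ++ u ++ s → factor (i + length p) (length u) ≡ u
  factor-infix i n [] u eq = trans (cong (λ j → factor j (length u)) (+-identityʳ i)) (factor-prefix i n u eq)
  factor-infix i (suc n) (c ∷ p) u eq =
    trans (cong (λ j → factor j (length u)) (+-suc i (length p))) (factor-infix (suc i) n p u (∷-injectiveʳ eq))

  applyUpTo≡factor : ∀ {f : ℕ → Fin k} i n → (∀ j → f j ≡ x (i + j)) → applyUpTo f n ≡ factor i n
  applyUpTo≡factor i zero _ = refl
  applyUpTo≡factor i (suc n) f≗ =
    cong₂ _∷_ (trans (f≗ 0) (cong x (+-identityʳ i)))
              (applyUpTo≡factor (suc i) n (λ j → trans (f≗ (suc j)) (cong x (+-suc i j))))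

  factorAt≡factor : ∀ i n → factorAt x i n ≡ factor i n
  factorAt≡factor i n = trans (map-upTo _ n) (applyUpTo≡factor i n (λ _ → refl))

  factor-isFactor : ∀ i n → IsFactorOfLength x n (factor i n)
  factor-isFactor i n = (i , trans (cong (factorAt x i) (length-factor i n)) (factorAt≡factor i n)) , length-factor i n

  isFactor⇒factor : ∀ {w} → IsFactor x w → ∃ λ i → factor i (length w) ≡ w
  isFactor⇒factor (i , eq) = i , trans (sym (factorAt≡factor i _)) eq

  isFactorOfLength⇒factor : ∀ {n w} → IsFactorOfLength x n w → ∃ λ i → factor i n ≡ w
  isFactorOfLength⇒factor (isFactor , refl) = isFactor⇒factor isFactor

  factor-∈-allFactors-prefix : ∀ {j ℓ n} → j + ℓ ≤ n → factor j ℓ ∈ allFactors (prefix n)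
  factor-∈-allFactors-prefix {j} {ℓ} j+ℓ≤n with m≤n⇒∃[o]m+o≡n j+ℓ≤n
  ... | b , refl = subst (λ z → factor j ℓ ∈ allFactors z) (sym decomposition)
                     (∈-allFactors⁺ (prefix j) (factor j ℓ) (factor (j + ℓ) b))
    where
    open ≡-Reasoning
    decomposition : prefix (j + ℓ + b) ≡ prefix j ++ factor j ℓ ++ factor (j + ℓ) b
    decomposition = begin
      prefix (j + ℓ + b)                        ≡⟨ cong prefix (+-assoc j ℓ b) ⟩
      prefix (j + (ℓ + b))                      ≡⟨ factor-++ 0 j (ℓ + b) ⟩
      prefix j ++ factor j (ℓ + b)              ≡⟨ cong (prefix j ++_) (factor-++ j ℓ b) ⟩
      prefix j ++ factor j ℓ ++ factor (j + ℓ) b ∎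

  ∈-allFactors-prefix⁻ : ∀ {u n} → u ∈ allFactors (prefix n) →
                         ∃ λ j → j + length u ≤ n × factor j (length u) ≡ u
  ∈-allFactors-prefix⁻ {u} {n} mem with ∈-allFactors⁻ (prefix n) mem
  ... | p , s , eq = length p , bound , factor-infix 0 n p u eq
    where
    open ≤-Reasoning
    bound : length p + length u ≤ n
    bound = begin
      length p + length u                 ≤⟨ m≤m+n (length p + length u) (length s) ⟩
      length p + length u + length s      ≡⟨ +-assoc (length p) (length u) (length s) ⟩
      length p + (length u + length s)    ≡⟨ cong (length p +_) (sym (length-++ u)) ⟩
      length p + length (u ++ s)          ≡⟨ sym (length-++ p) ⟩
      length (p ++ u ++ s)                ≡⟨ cong length (sym eq) ⟩
      length (prefix n)                   ≡⟨ length-factor 0 n ⟩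
      n                                   ∎

  factor-∈-allFactors-prefix⁻ : ∀ {p ℓ n} → factor p ℓ ∈ allFactors (prefix n) →
                                ∃ λ j → j + ℓ ≤ n × factor j ℓ ≡ factor p ℓ
  factor-∈-allFactors-prefix⁻ {p} {ℓ} mem with ∈-allFactors-prefix⁻ mem
  ... | j , bound , eq rewrite length-factor p ℓ = j , bound , eq

  factor-init : ∀ {i j} n → factor i (suc n) ≡ factor j (suc n) → factor i n ≡ factor j n
  factor-init {i} {j} n eq =
    ∷ʳ-injective (factor i n) (factor j n) (trans (sym (factor-∷ʳ i n)) (trans eq (factor-∷ʳ j n))) .proj₁

  factor-init-reverse : ∀ {i j} n → factor j (suc n) ≡ reverse (factor i (suc n)) →
                        factor j n ≡ reverse (factor (suc i) n)
  factor-init-reverse {i} {j} n eq = ∷ʳ-injective (factor j n) (reverse (factor (suc i) n))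
    (trans (sym (factor-∷ʳ j n)) (trans eq (unfold-reverse (x i) (factor (suc i) n)))) .proj₁

  factor-suffix : ∀ {i j} c ℓ → factor i (c + ℓ) ≡ factor j (c + ℓ) → factor (i + c) ℓ ≡ factor (j + c) ℓ
  factor-suffix {i} {j} c ℓ eq = ++-injective (factor i c) (factor j c) (trans (length-factor i c) (sym (length-factor j c)))
    (trans (sym (factor-++ i c ℓ)) (trans eq (factor-++ j c ℓ))) .proj₂

  factor-palindrome : ∀ p d m → Palindrome (factor p (d + m)) → factor p m ≡ reverse (factor (p + d) m)
  factor-palindrome p d m pal = palindrome-++-prefix (factor p d) (factor (p + d) m) (factor p m)
    (subst Palindrome (factor-++ p d m) pal)
    (trans (sym (factor-++ p m d)) (trans (cong (factor p) (+-comm m d)) (factor-++ p d m)))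
    (trans (length-factor p m) (sym (length-factor (p + d) m)))

  -- Richness and new palindromic suffixes

  New : ℕ → ℕ → Set
  New ℓ p = ∀ {j} → j < p → factor j ℓ ≢ factor p ℓ

  NewPalSuffix : ℕ → Set
  NewPalSuffix n = ∃₂ λ p ℓ → p + ℓ ≡ n × Palindrome (factor p ℓ) × New ℓ p

  palCount-prefix-< : ∀ m → NewPalSuffix (suc m) → palCount (prefix m) < palCount (prefix (suc m))
  palCount-prefix-< m (p , ℓ , p+ℓ≡1+m , pal , first) =
    palCount-< (prefix (suc m)) (prefix m) prefix⊆ pal (factor-∈-allFactors-prefix (≤-reflexive p+ℓ≡1+m)) notInPrefix
    where
    prefix⊆ : ∀ {u} → u ∈ allFactors (prefix m) → u ∈ allFactors (prefix (suc m))
    prefix⊆ {u} mem =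
      subst (λ z → u ∈ allFactors z) (sym (factor-∷ʳ 0 m)) (∈-allFactors-++⁺ (prefix m) [ x m ] mem)
    notInPrefix : factor p ℓ ∉ allFactors (prefix m)
    notInPrefix mem with factor-∈-allFactors-prefix⁻ mem
    ... | j , j+ℓ≤m , eq = first (+-cancelʳ-< ℓ j p (subst (j + ℓ <_) (sym p+ℓ≡1+m) (s≤s j+ℓ≤m))) eq

  palCount-prefix-≤ : ∀ m → ¬ NewPalSuffix (suc m) → palCount (prefix (suc m)) ≤ palCount (prefix m)
  palCount-prefix-≤ m ¬new = palCount-mono (prefix (suc m)) (prefix m) palInPrefix
    where
    palInPrefix : ∀ {u} → Palindrome u → u ∈ allFactors (prefix (suc m)) → u ∈ allFactors (prefix m)
    palInPrefix {u} pal mem with ∈-allFactors-prefix⁻ mem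
    ... | j , j+ℓ≤1+m , eq with least (λ i → factor i (length u) ≟w u) (suc j) (j , ≤-refl , eq)
    ...   | p , p<1+j , eqₚ , minimal
            with m≤n⇒m<n∨m≡n {n = suc m} (≤-trans (+-monoˡ-≤ (length u) (≤-pred p<1+j)) j+ℓ≤1+m)
    ...     | inj₁ (s≤s p+ℓ≤m) = subst (_∈ allFactors (prefix m)) eqₚ (factor-∈-allFactors-prefix p+ℓ≤m)
    ...     | inj₂ p+ℓ≡1+m =
      ⊥-elim (¬new (p , length u , p+ℓ≡1+m , subst Palindrome (sym eqₚ) pal ,
                    λ j<p eqⱼ → minimal j<p (trans eqⱼ eqₚ)))

  palCount-prefix : Rich x → ∀ n → palCount (prefix n) ≡ suc n
  palCount-prefix rich n =
    trans (rich (prefix n) (factor-isFactor 0 n .proj₁)) (trans (cong (_+ 1) (length-factor 0 n)) (+-comm n 1))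

  rich⇒newPalSuffix : Rich x → ∀ m → ¬ ¬ NewPalSuffix (suc m)
  rich⇒newPalSuffix rich m ¬new =
    1+n≰n (subst₂ _≤_ (palCount-prefix rich (suc m)) (palCount-prefix rich m) (palCount-prefix-≤ m ¬new))

  module _ (new : ∀ m → NewPalSuffix (suc m)) where

    palCount-prefix-≥ : ∀ m → suc m ≤ palCount (prefix m)
    palCount-prefix-≥ zero = ≤-refl
    palCount-prefix-≥ (suc m) = ≤-trans (s≤s (palCount-prefix-≥ m)) (palCount-prefix-< m (new m))

    palCount-factor : ∀ i ℓ → palCount (factor i ℓ) ≡ suc ℓ
    palCount-factor i ℓ = ≤-antisym upper lower
      where
      open ≤-Reasoning
      upper : palCount (factor i ℓ) ≤ suc ℓ
      upper = subst (λ n → palCount (factor i ℓ) ≤ suc n) (length-factor i ℓ) (palCount-≤-length (factor i ℓ))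
      lower : suc ℓ ≤ palCount (factor i ℓ)
      lower = +-cancelˡ-≤ i (suc ℓ) (palCount (factor i ℓ)) (begin
        i + suc ℓ                                    ≡⟨ +-suc i ℓ ⟩
        suc (i + ℓ)                                  ≤⟨ palCount-prefix-≥ (i + ℓ) ⟩
        palCount (prefix (i + ℓ))                    ≡⟨ cong palCount (factor-++ 0 i ℓ) ⟩
        palCount (prefix i ++ factor i ℓ)            ≤⟨ palCount-++-≤ (prefix i) (factor i ℓ) ⟩
        length (prefix i) + palCount (factor i ℓ)    ≡⟨ cong (_+ palCount (factor i ℓ)) (length-factor 0 i) ⟩
        i + palCount (factor i ℓ)                    ∎)

    newPalSuffix⇒rich : Rich x
    newPalSuffix⇒rich w isFactor = let (i , eq) = isFactor⇒factor isFactor in begin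
      palCount w                    ≡⟨ cong palCount (sym eq) ⟩
      palCount (factor i (length w)) ≡⟨ palCount-factor i (length w) ⟩
      suc (length w)                ≡⟨ +-comm 1 (length w) ⟩
      length w + 1                  ∎
      where open ≡-Reasoning

  -- Counting factors by first occurrences

  Window : ℕ → ℕ → Set
  Window ℓ N = ∀ w → IsFactorOfLength x ℓ w → ∃ λ i → i < N × factor i ℓ ≡ w

  window-exists : ∀ {ℓ c} → FactorComplexity x ℓ c → ∃ (Window ℓ)
  window-exists {ℓ} (L , _ , factors , _ , cover) =
    let (N , below) = All-∃-bounded L (All.map isFactorOfLength⇒factor factors)
    in N , λ w isFactor → All.lookup below (cover w isFactor)

  window-mono : ∀ {ℓ N N′} → N ≤ N′ → Window ℓ N → Window ℓ N′
  window-mono N≤N′ window w isFactor = let (i , i<N , eq) = window w isFactor in i , <-≤-trans i<N N≤N′ , eq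

  window-init : ∀ {n N} → Window (suc n) N → Window n (suc N)
  window-init {n} window w isFactor =
    let (i₀ , eq₀) = isFactorOfLength⇒factor isFactor
        (i , i<N , eq) = window (factor i₀ (suc n)) (factor-isFactor i₀ (suc n))
    in i , m<n⇒m<1+n i<N , trans (factor-init n eq) eq₀

  ReflNew : ℕ → ℕ → Set
  ReflNew ℓ i = ∀ {j} → j < i → ¬ ReflEquiv (factor j ℓ) (factor i ℓ)

  ReflNew? : ∀ ℓ → Decidable (ReflNew ℓ)
  ReflNew? ℓ i = allUpTo? (λ j → ¬? (ReflEquiv? (factor j ℓ) (factor i ℓ))) i

  NonPalNew : ℕ → ℕ → Set
  NonPalNew ℓ i = ReflNew ℓ i × ¬ Palindrome (factor i ℓ)

  NonPalNew? : ∀ ℓ → Decidable (NonPalNew ℓ)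
  NonPalNew? ℓ i = ReflNew? ℓ i ×-dec ¬? (factor i ℓ ≟w reverse (factor i ℓ))

  ReflNew-representative : ∀ {ℓ N w} → Window ℓ N → IsFactorOfLength x ℓ w →
                           ∃ λ i → i < N × ReflNew ℓ i × ReflEquiv w (factor i ℓ)
  ReflNew-representative {ℓ} {N} {w} window isFactor =
    let (i₀ , i₀<N , eq₀) = window w isFactor
        (i , i<N , w≈i , minimal) = least (λ i → ReflEquiv? w (factor i ℓ)) N (i₀ , i₀<N , inj₁ eq₀)
    in i , i<N , (λ j<i j≈i → minimal j<i (ReflEquiv-trans w≈i (ReflEquiv-sym j≈i))) , w≈i

  reflReps : ℕ → ℕ → List (Word k)
  reflReps ℓ N = map (λ i → factor i ℓ) (filter (ReflNew? ℓ) (upTo N))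

  reflReps-factors : ∀ ℓ N → All (IsFactorOfLength x ℓ) (reflReps ℓ N)
  reflReps-factors ℓ N = Allₚ.map⁺ (All.tabulate (λ {i} _ → factor-isFactor i ℓ))

  reflReps-distinct : ∀ ℓ N → AllPairs (λ u v → ¬ ReflEquiv u v) (reflReps ℓ N)
  reflReps-distinct ℓ N =
    AllPairsₚ.map⁺ (AllPairs-filter⁺ (ReflNew? ℓ) (AllPairsₚ.applyUpTo⁺₁ id N (λ i<j _ newⱼ → newⱼ i<j)))

  reflReps-count : ∀ {ℓ N} → Window ℓ N → ReflComplexity x ℓ (count (ReflNew? ℓ) N)
  reflReps-count {ℓ} {N} window =
    reflReps ℓ N , length-map _ (filter (ReflNew? ℓ) (upTo N)) , reflReps-factors ℓ N , reflReps-distinct ℓ N , cover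
    where
    cover : ∀ w → IsFactorOfLength x ℓ w → Any (ReflEquiv w) (reflReps ℓ N)
    cover w isFactor = let (i , i<N , newᵢ , w≈i) = ReflNew-representative window isFactor
                       in lose (∈-map-filter-upTo⁺ (ReflNew? ℓ) (λ i → factor i ℓ) i<N newᵢ) w≈i

  nonPalReps : ℕ → ℕ → List (Word k)
  nonPalReps ℓ N = map (λ i → reverse (factor i ℓ)) (filter (NonPalNew? ℓ) (upTo N))

  factorReps : ℕ → ℕ → List (Word k)
  factorReps ℓ N = reflReps ℓ N ++ nonPalReps ℓ N

  factorReps-count : ∀ {ℓ N} → ReversalClosed x → Window ℓ N →
                     FactorComplexity x ℓ (count (ReflNew? ℓ) N + count (NonPalNew? ℓ) N)
  factorReps-count {ℓ} {N} closed window = factorReps ℓ N , lengthEq , factors , distinct , cover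
    where
    lengthEq : length (factorReps ℓ N) ≡ count (ReflNew? ℓ) N + count (NonPalNew? ℓ) N
    lengthEq = trans (length-++ (reflReps ℓ N))
      (cong₂ _+_ (length-map _ (filter (ReflNew? ℓ) (upTo N))) (length-map _ (filter (NonPalNew? ℓ) (upTo N))))

    reverse-isFactor : ∀ i → IsFactorOfLength x ℓ (reverse (factor i ℓ))
    reverse-isFactor i =
      closed (factor i ℓ) (factor-isFactor i ℓ .proj₁) , trans (length-reverse (factor i ℓ)) (length-factor i ℓ)

    factors : All (IsFactorOfLength x ℓ) (factorReps ℓ N)
    factors = Allₚ.++⁺ (reflReps-factors ℓ N) (Allₚ.map⁺ (All.tabulate (λ {i} _ → reverse-isFactor i)))

    reverses-distinct : ∀ {i j} → i < j → NonPalNew ℓ j → reverse (factor i ℓ) ≢ reverse (factor j ℓ)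
    reverses-distinct i<j (newⱼ , _) eq = newⱼ i<j (inj₁ (reverse-injective (sym eq)))

    cross-distinct : ∀ {i j} → ReflNew ℓ i → NonPalNew ℓ j → factor i ℓ ≢ reverse (factor j ℓ)
    cross-distinct {i} {j} newᵢ (newⱼ , nonPalⱼ) eq with <-cmp i j
    ... | tri< i<j _ _ = newⱼ i<j (ReflEquiv-sym (inj₂ eq))
    ... | tri≈ _ refl _ = nonPalⱼ eq
    ... | tri> _ _ j<i = newᵢ j<i (inj₂ eq)

    distinct : AllPairs _≢_ (factorReps ℓ N)
    distinct = AllPairsₚ.++⁺
      (AllPairs.map (λ i≉j i≡j → i≉j (inj₁ (sym i≡j))) (reflReps-distinct ℓ N))
      (AllPairsₚ.map⁺ (AllPairs-filter⁺ (NonPalNew? ℓ)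
        (AllPairsₚ.applyUpTo⁺₁ id N (λ i<j _ → reverses-distinct i<j))))
      (Allₚ.map⁺ (All.map distinct-from-nonPalReps (Allₚ.all-filter (ReflNew? ℓ) (upTo N))))
      where
      distinct-from-nonPalReps : ∀ {i} → ReflNew ℓ i → All (factor i ℓ ≢_) (nonPalReps ℓ N)
      distinct-from-nonPalReps newᵢ =
        Allₚ.map⁺ (All.map (cross-distinct newᵢ) (Allₚ.all-filter (NonPalNew? ℓ) (upTo N)))

    cover : ∀ w → IsFactorOfLength x ℓ w → Any (w ≡_) (factorReps ℓ N)
    cover w isFactor with ReflNew-representative window isFactor
    ... | i , i<N , newᵢ , inj₁ i≡w =
      Anyₚ.++⁺ˡ (lose (∈-map-filter-upTo⁺ (ReflNew? ℓ) (λ i → factor i ℓ) i<N newᵢ) (sym i≡w))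
    ... | i , i<N , newᵢ , inj₂ i≡w⁻¹ with factor i ℓ ≟w reverse (factor i ℓ)
    ...   | yes pal = Anyₚ.++⁺ˡ
      (lose (∈-map-filter-upTo⁺ (ReflNew? ℓ) (λ i → factor i ℓ) i<N newᵢ) (trans (sym (reverse-selfInverse (sym i≡w⁻¹))) (sym pal)))
    ...   | no nonPal = Anyₚ.++⁺ʳ (reflReps ℓ N)
      (lose (∈-map-filter-upTo⁺ (NonPalNew? ℓ) (λ i → reverse (factor i ℓ)) i<N (newᵢ , nonPal)) (sym (reverse-selfInverse (sym i≡w⁻¹))))

  complexities⇔counts : ∀ {n N a b c} → ReversalClosed x → Window (suc n) N →
    ReflComplexity x (suc n) a → ReflComplexity x n b → FactorComplexity x (suc n) c →
    (a + b ≡ c + 1) ⇔ (count (ReflNew? n ∘ suc) N ≡ count (NonPalNew? (suc n)) N)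
  complexities⇔counts {n} {N} closed window rₐ r_b ρ
    with CountUpTo-functional ReflEquiv-isEquivalence {x = x} rₐ (reflReps-count window)
       | CountUpTo-functional ReflEquiv-isEquivalence {x = x} r_b (reflReps-count (window-init window))
       | CountUpTo-functional ≡.isEquivalence {x = x} ρ (factorReps-count closed window)
  ... | refl | refl | refl rewrite count-suc (ReflNew? n) {N} (λ ()) =
    mk⇔ (λ eq → +-cancelˡ-≡ A B C (suc-injective (trans (sym (+-suc A B)) (trans eq (+-comm (A + C) 1)))))
        (λ B≡C → trans (+-suc A B) (trans (+-comm 1 (A + B)) (cong (λ z → A + z + 1) B≡C)))
    where
    A = count (ReflNew? (suc n)) N
    B = count (ReflNew? n ∘ suc) N
    C = count (NonPalNew? (suc n)) N

  ReflNew-stable : ∀ {ℓ i} → ¬ ¬ ReflNew ℓ i → ReflNew ℓ i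
  ReflNew-stable ¬¬new j<i j≈i = ¬¬new (λ new → new j<i j≈i)

  ReflNew⇒New : ∀ {ℓ i} → ReflNew ℓ i → New ℓ i
  ReflNew⇒New new j<i eq = new j<i (inj₁ (sym eq))

  ReflNew-suc⇒NonPalNew : ∀ n {i} → ReflNew n (suc i) → NonPalNew (suc n) i
  ReflNew-suc⇒NonPalNew n {i} new = earlier , nonPal
    where
    reversed-earlier : ∀ {j} → j < suc i → factor j (suc n) ≢ reverse (factor i (suc n))
    reversed-earlier j<1+i eq = new j<1+i (ReflEquiv-sym (inj₂ (factor-init-reverse n eq)))
    earlier : ReflNew (suc n) i
    earlier j<i (inj₁ eq) = new (s≤s j<i) (inj₁ (∷-injectiveʳ eq))
    earlier j<i (inj₂ eq) = reversed-earlier (m<n⇒m<1+n j<i) (sym (reverse-selfInverse (sym eq)))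
    nonPal : ¬ Palindrome (factor i (suc n))
    nonPal = reversed-earlier (n<1+n i)

  palSuffix⇒ReflNew : ∀ i c ℓ → Palindrome (factor (suc i + c) ℓ) → New ℓ (suc i + c) →
                      ReflNew (c + ℓ) (suc i)
  palSuffix⇒ReflNew i c ℓ pal first {j} j<1+i (inj₁ eq) =
    first (+-monoˡ-< c j<1+i) (factor-suffix c ℓ (sym eq))
  palSuffix⇒ReflNew i c ℓ pal first {j} j<1+i (inj₂ eq) =
    first (≤-trans j<1+i (m≤m+n (suc i) c))
      (reverse-++-palindrome (factor (suc i) c) (factor (suc i + c) ℓ) (factor j ℓ) pal
      (begin
        factor j ℓ ++ factor (j + ℓ) c               ≡⟨ factor-++ j ℓ c ⟨
        factor j (ℓ + c)                              ≡⟨ cong (factor j) (+-comm ℓ c) ⟩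
        factor j (c + ℓ)                              ≡⟨ reverse-involutive (factor j (c + ℓ)) ⟨
        reverse (reverse (factor j (c + ℓ)))          ≡⟨ cong reverse eq ⟨
        reverse (factor (suc i) (c + ℓ))              ≡⟨ cong reverse (factor-++ (suc i) c ℓ) ⟩
        reverse (factor (suc i) c ++ factor (suc i + c) ℓ) ∎)
      (trans (length-factor j ℓ) (sym (length-factor (suc i + c) ℓ))))
    where open ≡-Reasoning

  palSuffix⇒¬NonPalNew : ∀ p d n → Palindrome (factor p (d + suc n)) → ¬ NonPalNew (suc n) (p + d)
  palSuffix⇒¬NonPalNew p d n pal (new , nonPal) with m≤n⇒m<n∨m≡n (m≤m+n p d)
  ... | inj₁ p<p+d = new p<p+d (ReflEquiv-sym (inj₂ (factor-palindrome p d (suc n) pal)))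
  ... | inj₂ p≡p+d =
    nonPal (subst (λ q → factor q (suc n) ≡ reverse (factor (p + d) (suc n))) p≡p+d (factor-palindrome p d (suc n) pal))

  newPalSuffix⇒ReflNew : ∀ n i → NewPalSuffix (suc (i + n)) → NonPalNew (suc n) i → ReflNew n (suc i)
  newPalSuffix⇒ReflNew n i (p , ℓ , p+ℓ≡ , pal , first) nonPalNew with ≤-<-connex ℓ n
  ... | inj₁ ℓ≤n with m≤n⇒∃[o]m+o≡n ℓ≤n
  ...   | c , refl with +-cancelʳ-≡ ℓ p (suc i + c) (trans p+ℓ≡ (cong suc (x∙yz≈xz∙y i ℓ c)))
  ...     | refl = subst (λ m → ReflNew m (suc i)) (+-comm c ℓ) (palSuffix⇒ReflNew i c ℓ pal first)
  newPalSuffix⇒ReflNew n i (p , ℓ , p+ℓ≡ , pal , first) nonPalNew | inj₂ n<ℓ with m≤n⇒∃[o]m+o≡n n<ℓ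
  ... | d , refl with +-cancelʳ-≡ (suc n) (p + d) i (trans (xy∙z≈x∙zy p d (suc n)) (trans p+ℓ≡ (sym (+-suc i n))))
  ...   | refl =
    ⊥-elim (palSuffix⇒¬NonPalNew p d n (subst (λ m → Palindrome (factor p m)) (+-comm (suc n) d) pal) nonPalNew)

  TailsReflNew : Set
  TailsReflNew = ∀ n {i} → NonPalNew (suc n) i → ReflNew n (suc i)

  -- Richness yields the new palindromic suffix only up to double negation, which suffices
  -- because ReflNew is a negative statement.
  rich⇒TailsReflNew : Rich x → TailsReflNew
  rich⇒TailsReflNew rich n {i} nonPalNew =
    ReflNew-stable λ ¬new →
      rich⇒newPalSuffix rich (i + n) λ newPal → ¬new (newPalSuffix⇒ReflNew n i newPal nonPalNew)

  TailsReflNew⇒newPalSuffix : TailsReflNew → ∀ m → NewPalSuffix (suc m)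
  TailsReflNew⇒newPalSuffix tails m = search (suc m) 0 refl (λ ())
    where
    search : ∀ ℓ p → p + ℓ ≡ suc m → ReflNew ℓ p → NewPalSuffix (suc m)
    search zero p p+0≡1+m new = ⊥-elim (new (subst (0 <_) (sym (trans (sym (+-identityʳ p)) p+0≡1+m)) z<s) (inj₁ refl))
    search (suc ℓ) p p+ℓ≡ new with factor p (suc ℓ) ≟w reverse (factor p (suc ℓ))
    ... | yes pal = p , suc ℓ , p+ℓ≡ , pal , ReflNew⇒New new
    ... | no nonPal = search ℓ (suc p) (trans (sym (+-suc p ℓ)) p+ℓ≡) (tails ℓ (new , nonPal))

  TailsReflNew⇒rich : TailsReflNew → Rich x
  TailsReflNew⇒rich tails = newPalSuffix⇒rich (TailsReflNew⇒newPalSuffix tails)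

theorem7p1 : ∀ {k} (x : Seq k) → ReversalClosed x →
    (Rich x → ∀ n a b c → ReflComplexity x (suc n) a → ReflComplexity x n b →
       FactorComplexity x (suc n) c → a + b ≡ c + 1)
    × ((∀ n → ∃ λ a → ∃ λ b → ∃ λ c → ReflComplexity x (suc n) a × ReflComplexity x n b
       × FactorComplexity x (suc n) c × a + b ≡ c + 1) → Rich x)
theorem7p1 x closed = rich⇒identity , identity⇒rich
  where
  rich⇒identity : Rich x → ∀ n a b c → ReflComplexity x (suc n) a → ReflComplexity x n b →
                  FactorComplexity x (suc n) c → a + b ≡ c + 1
  rich⇒identity rich n a b c rₐ r_b ρ =
    let (N , window) = window-exists x ρ
    in Equivalence.from (complexities⇔counts x closed window rₐ r_b ρ) (≤-antisym
         (length-filter-mono (ReflNew? x n ∘ suc) (NonPalNew? x (suc n)) (ReflNew-suc⇒NonPalNew x n) (upTo N))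
         (length-filter-mono (NonPalNew? x (suc n)) (ReflNew? x n ∘ suc) (rich⇒TailsReflNew x rich n) (upTo N)))

  identity⇒rich : (∀ n → ∃ λ a → ∃ λ b → ∃ λ c → ReflComplexity x (suc n) a × ReflComplexity x n b
                    × FactorComplexity x (suc n) c × a + b ≡ c + 1) → Rich x
  identity⇒rich identity = TailsReflNew⇒rich x tails
    where
    tails : TailsReflNew x
    tails n {i} nonPalNew =
      let (a , b , c , rₐ , r_b , ρ , a+b≡c+1) = identity n
          (N , window) = window-exists x ρ
          window′ = window-mono x (m≤n+m N (suc i)) window
          counts≡ = Equivalence.to (complexities⇔counts x closed window′ rₐ r_b ρ) a+b≡c+1
      in length-filter-≡⇒⊇ (ReflNew? x n ∘ suc) (NonPalNew? x (suc n)) (ReflNew-suc⇒NonPalNew x n)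
           (upTo (suc i + N)) counts≡ (∈-upTo⁺ (s≤s (m≤m+n i N))) nonPalNew
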